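{- Let $V$ be a scanning function that is $g$-filling for a function $g\colon\mathbb{N}\to\mathbb{N}$, and let $\alpha,w\in\{0,1\}^*$ with $|\alpha| \ge i := g(|w|)$. Then $\alpha \sim_V w$ if and only if $\alpha\upharpoonright i \sim_V w$.
   Context: A scanning function is a function $V\colon \{0,1\}^* \to \{0\}^*$ (values identified with natural numbers) such that $V(\alpha) \neq V(\alpha\upharpoonright i)$ for every $\alpha$ and every $i<|\alpha|$; $V(\alpha\upharpoonright j)$ is called the $j$-th query in the run of $V$ on $\alpha$. $V$ is $g$-filling if for every $n$ and every $\alpha\in\{0,1\}^{g(n)}$, for every $r<n$ there is $j$ with $V(\alpha\upharpoonright j)=r$. For bit strings $\alpha,w$, $\alpha\sim_V w$ means: for each $j<|\alpha|$, if the $j$-th query $x$ in the run of $V$ on $\alpha$ satisfies $x<|w|$, then $w(x)=\alpha(j)$. -}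

module Defs where

open import Data.Bool using (Bool)
open import Data.Nat using (ℕ; _<_)
open import Data.Fin using (Fin; toℕ; fromℕ<)
open import Data.List using (List; length; take; lookup)
open import Data.Product using (Σ; ∃)
open import Relation.Binary.PropositionalEquality using (_≡_; _≢_)

-- Bit strings are lists of booleans; α ↾ i is  take i α.
-- Outputs of V in {0}^* are identified with natural numbers.

IsScanning : (List Bool → ℕ) → Set
IsScanning V = ∀ (α : List Bool) (i : ℕ) → i < length α → V α ≢ V (take i α)

-- the j-th query in the run of V on α (meaningful for j < |α|)
query : (List Bool → ℕ) → List Bool → ℕ → ℕ
query V α j = V (take j α)

IsFilling : (List Bool → ℕ) → (ℕ → ℕ) → Set
IsFilling V g = ∀ (n : ℕ) (α : List Bool) → length α ≡ g n →
  ∀ (r : ℕ) → r < n → ∃ λ (j : ℕ) → Σ (j < length α) λ _ → query V α j ≡ r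

Agrees : (List Bool → ℕ) → List Bool → List Bool → Set
Agrees V α w = ∀ (j : Fin (length α)) (p : query V α (toℕ j) < length w) →
  lookup w (fromℕ< p) ≡ lookup α j

-- The run of V on a prefix α ↾ m is the first m steps of its run on α, so
-- shortening α can only remove constraints.  Conversely, once i = g(|w|) steps
-- have been made, the filling property has already queried every position below
-- |w|; a later query below |w| would repeat an earlier one, which scanning
-- forbids.  Hence all queries after step i are out of range and impose nothing.
module Submission where

open import Defs
open import Data.Bool using (Bool)
open import Data.Nat using (ℕ; _≤_; _<_; suc)
open import Data.Nat.Properties
open import Data.List using (List; length; take; lookup; _∷_)
open import Data.List.Properties using (take-take; length-take)
open import Data.Fin using (Fin; toℕ; fromℕ<) renaming (zero to fzero; suc to fsuc)
open import Data.Fin.Properties using (toℕ-fromℕ<; toℕ<n; fromℕ<-cong)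
open import Data.Product using (_,_)
open import Data.Empty using (⊥)
open import Relation.Nullary using (yes; no; contradiction)
open import Relation.Binary.PropositionalEquality
open import Function.Bundles using (_⇔_; mk⇔; Equivalence)

private
  variable
    A : Set

length-take-≤ : ∀ m (xs : List A) → m ≤ length xs → length (take m xs) ≡ m
length-take-≤ m xs m≤ = trans (length-take m xs) (m≤n⇒m⊓n≡m m≤)

take-take-≤ : ∀ k m (xs : List A) → k ≤ m → take k (take m xs) ≡ take k xs
take-take-≤ k m xs k≤m = trans (take-take k m xs) (cong (λ n → take n xs) (m≤n⇒m⊓n≡m k≤m))

toℕ<length-take : ∀ m (xs : List A) (i : Fin (length (take m xs))) → toℕ i < length xs
toℕ<length-take m xs i = <-≤-trans (toℕ<n i) (≤-trans (≤-reflexive (length-take m xs)) (m⊓n≤n m _))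

toℕ<take : ∀ m (xs : List A) (i : Fin (length (take m xs))) → toℕ i < m
toℕ<take m xs i = <-≤-trans (toℕ<n i) (≤-trans (≤-reflexive (length-take m xs)) (m⊓n≤m m _))

lookup-take : ∀ m (xs : List A) (i : Fin (length (take m xs))) (i′ : Fin (length xs)) →
  toℕ i ≡ toℕ i′ → lookup (take m xs) i ≡ lookup xs i′
lookup-take (suc m) (x ∷ xs) fzero    fzero     _ = refl
lookup-take (suc m) (x ∷ xs) (fsuc i) (fsuc i′) e = lookup-take m xs i i′ (suc-injective e)

lookup-fromℕ<-cong : ∀ (xs : List A) {x y} → x ≡ y →
  (x< : x < length xs) (y< : y < length xs) → lookup xs (fromℕ< x<) ≡ lookup xs (fromℕ< y<)
lookup-fromℕ<-cong xs {x} {y} x≡y x< y< = cong (lookup xs) (fromℕ<-cong x y x≡y x< y<)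

module _ (V : List Bool → ℕ) where

  query-take : ∀ m α {j} → j < m → query V (take m α) j ≡ query V α j
  query-take m α {j} j<m = cong V (take-take-≤ j m α (<⇒≤ j<m))

  agrees-at-take : ∀ m α w (i : Fin (length (take m α))) (i′ : Fin (length α)) →
    toℕ i ≡ toℕ i′ →
    (p : query V (take m α) (toℕ i) < length w) (p′ : query V α (toℕ i′) < length w) →
    (lookup w (fromℕ< p) ≡ lookup (take m α) i) ⇔ (lookup w (fromℕ< p′) ≡ lookup α i′)
  agrees-at-take m α w i i′ i≡i′ p p′ = mk⇔
    (λ agree → trans (sym same-bit-of-w) (trans agree same-bit-of-α))
    (λ agree′ → trans same-bit-of-w (trans agree′ (sym same-bit-of-α)))
    where
    same-bit-of-w : lookup w (fromℕ< p) ≡ lookup w (fromℕ< p′)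
    same-bit-of-w = lookup-fromℕ<-cong w
      (trans (query-take m α (toℕ<take m α i)) (cong (query V α) i≡i′)) p p′
    same-bit-of-α : lookup (take m α) i ≡ lookup α i′
    same-bit-of-α = lookup-take m α i i′ i≡i′

  Agrees-take : ∀ m α w → Agrees V α w → Agrees V (take m α) w
  Agrees-take m α w agrees i p =
    Equivalence.from (agrees-at-take m α w i i′ (sym (toℕ-fromℕ< i<)) p p′) (agrees i′ p′)
    where
    i< = toℕ<length-take m α i
    i′ = fromℕ< i<
    p′ : query V α (toℕ i′) < length w
    p′ = subst (_< length w)
      (trans (query-take m α (toℕ<take m α i)) (cong (query V α) (sym (toℕ-fromℕ< i<)))) p

  Agrees-take⁻¹ : ∀ m α w → (∀ j → m ≤ j → j < length α → length w ≤ query V α j) →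
    Agrees V (take m α) w → Agrees V α w
  Agrees-take⁻¹ m α w late agrees i p with toℕ i <? m
  ... | no  i≮m = contradiction p (≤⇒≯ (late (toℕ i) (≮⇒≥ i≮m) (toℕ<n i)))
  ... | yes i<m = Equivalence.to (agrees-at-take m α w i′ i i≡i′ p′ p) (agrees i′ p′)
    where
    i′ = fromℕ< {n = length (take m α)}
      (subst (toℕ i <_) (sym (length-take m α)) (⊓-pres-m< i<m (toℕ<n i)))
    i≡i′ : toℕ i′ ≡ toℕ i
    i≡i′ = toℕ-fromℕ< _
    p′ : query V (take m α) (toℕ i′) < length w
    p′ = subst (_< length w)
      (trans (sym (query-take m α i<m)) (cong (query V (take m α)) (sym i≡i′))) p

  late-query-≥ : ∀ g → IsScanning V → IsFilling V g →
    ∀ n α j → g n ≤ j → j < length α → n ≤ query V α j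
  late-query-≥ g scanning filling n α j gn≤j j<α = ≮⇒≥ query<n⇒⊥
    where
    prefix-length : length (take (g n) α) ≡ g n
    prefix-length = length-take-≤ (g n) α (≤-trans gn≤j (<⇒≤ j<α))
    query<n⇒⊥ : query V α j < n → ⊥
    query<n⇒⊥ q<n with filling n (take (g n) α) prefix-length (query V α j) q<n
    ... | k , k<prefix , repeats = scanning (take j α) k k<j′ (begin
      V (take j α)              ≡⟨ repeats ⟨
      query V (take (g n) α) k  ≡⟨ query-take (g n) α k<gn ⟩
      query V α k               ≡⟨ query-take j α k<j ⟨
      V (take k (take j α))     ∎)
      where
      open ≡-Reasoning
      k<gn = subst (k <_) prefix-length k<prefix
      k<j  = <-≤-trans k<gn gn≤j
      k<j′ : k < length (take j α)
      k<j′ = subst (k <_) (sym (length-take-≤ j α (<⇒≤ j<α))) k<j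

lemma4p4 : (V : List Bool → ℕ) (g : ℕ → ℕ) → IsScanning V → IsFilling V g →
    (α w : List Bool) → g (length w) ≤ length α →
    Agrees V α w ⇔ Agrees V (take (g (length w)) α) w
lemma4p4 V g scanning filling α w _ = mk⇔
  (Agrees-take V i α w)
  (Agrees-take⁻¹ V i α w (λ j → late-query-≥ V g scanning filling (length w) α j))
  where i = g (length w)
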